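{- Let $k\geq 3$ and let $A,B$ be satisfying assignments of an instance $\Phi$ of 1-in-$k$ SAT. Then the set $\{x: A(x)=B(x)\}$ is a cover of $\Phi$, i.e., every clause of $\Phi$ contains at least one variable $x$ with $A(x)=B(x)$.
   Context: An instance of 1-in-$k$ SAT is a propositional formula in clausal form in which every clause consists of exactly $k$ literals on $k$ distinct variables; a satisfying assignment makes exactly one literal true in every clause. A cover of a formula $\Phi$ is a set $W$ of variables such that every clause of $\Phi$ contains at least one variable in $W$. -}

module Defs where

open import Data.Nat using (ℕ)
open import Data.Bool using (Bool; true; false; not)
open import Data.Fin using (Fin)
open import Data.Vec using (Vec; lookup)
open import Data.List using (List)
open import Data.List.Membership.Propositional using (_∈_)
open import Data.Product using (_×_; ∃; proj₁; proj₂)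
open import Relation.Binary.PropositionalEquality using (_≡_; _≢_)

Var : ℕ → Set
Var n = Fin n

record Literal (n : ℕ) : Set where
  constructor lit
  field
    var      : Var n
    positive : Bool
open Literal public

record Clause (n k : ℕ) : Set where
  constructor clause
  field
    lits     : Vec (Literal n) k
    distinct : ∀ (i j : Fin k) → var (lookup lits i) ≡ var (lookup lits j) → i ≡ j
open Clause public

Instance : ℕ → ℕ → Set
Instance n k = List (Clause n k)

Assignment : ℕ → Set
Assignment n = Var n → Bool

litVal : ∀ {n} → Assignment n → Literal n → Bool
litVal A (lit x true)  = A x
litVal A (lit x false) = not (A x)

ExactlyOneTrue : ∀ {n k} → Assignment n → Clause n k → Set
ExactlyOneTrue {k = k} A C =
  ∃ λ (i : Fin k) → (litVal A (lookup (lits C) i) ≡ true)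
                   × (∀ (j : Fin k) → j ≢ i → litVal A (lookup (lits C) j) ≡ false)

Satisfies : ∀ {n k} → Assignment n → Instance n k → Set
Satisfies A Φ = ∀ C → C ∈ Φ → ExactlyOneTrue A C

ContainsVar : ∀ {n k} → Clause n k → Var n → Set
ContainsVar {k = k} C x = ∃ λ (i : Fin k) → var (lookup (lits C) i) ≡ x

IsCover : ∀ {n k} → (Var n → Set) → Instance n k → Set
IsCover W Φ = ∀ C → C ∈ Φ → ∃ λ x → ContainsVar C x × W x

-- Under a 1-in-k assignment all but one literal of each clause is false.
-- For A and B these exceptional positions are at most two, so with k ≥ 3
-- some position m is false under both; a literal false under two
-- assignments forces them to agree on its variable.
module Submission where

open import Defs
open import Data.Nat using (ℕ; suc; _≥_; s≤s; z≤n)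
open import Data.Bool using (true; false)
open import Data.Bool.Properties using (not-injective)
open import Data.Fin using (Fin; zero; punchIn; punchOut)
open import Data.Fin.Properties using (_≟_; punchInᵢ≢i; punchIn-injective; punchIn-punchOut)
open import Data.Vec using (lookup)
open import Data.Product using (_×_; _,_; ∃)
open import Relation.Nullary using (yes; no)
open import Relation.Binary.PropositionalEquality using (_≡_; _≢_; refl; sym; trans)

avoid-two : ∀ {n} → Fin n → (i j : Fin (suc (suc n))) → ∃ λ m → m ≢ i × m ≢ j
avoid-two c i j with i ≟ j
... | yes refl = punchIn i zero , punchInᵢ≢i i zero , punchInᵢ≢i i zero
... | no i≢j   = punchIn i (punchIn p c) , punchInᵢ≢i i _ , avoids-j
  where
  p : Fin (suc _)
  p = punchOut i≢j

  avoids-j : punchIn i (punchIn p c) ≢ j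
  avoids-j eq = punchInᵢ≢i p c (punchIn-injective i _ _ (trans eq (sym (punchIn-punchOut i≢j))))

litVal-false-agree : ∀ {n} (A B : Assignment n) (l : Literal n) →
  litVal A l ≡ false → litVal B l ≡ false → A (var l) ≡ B (var l)
litVal-false-agree A B (lit x true)  Al Bl = trans Al (sym Bl)
litVal-false-agree A B (lit x false) Al Bl = not-injective (trans Al (sym Bl))

lemma2 : (n k : ℕ) → k ≥ 3 → (Φ : Instance n k) → (A B : Assignment n) →
    Satisfies A Φ → Satisfies B Φ →
    IsCover (λ x → A x ≡ B x) Φ
lemma2 n (suc (suc (suc k))) (s≤s (s≤s (s≤s z≤n))) Φ A B satA satB C C∈Φ
  with satA C C∈Φ | satB C C∈Φ
... | i , _ , onlyA | j , _ , onlyB with avoid-two zero i j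
... | m , m≢i , m≢j =
  var (lookup (lits C) m) , (m , refl) ,
  litVal-false-agree A B (lookup (lits C) m) (onlyA m m≢i) (onlyB m m≢j)
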